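{- Let $\mathcal{C}$ be a permutation class. If there exists a cyclic partial multiplication matrix $M$ such that $\mathcal{C}$ contains $M$-coils of arbitrarily large length, then $\mathcal{C}$ is not labelled well quasi-ordered.
   Context: Permutations are identified with their plots; $\sigma\le\pi$ means some subsequence of $\pi$ is order isomorphic to $\sigma$; a permutation class is a downward-closed set of permutations. A gridding matrix is a matrix with entries in $\{0,1,-1\}$ ($m$ columns, $n$ rows; $M_{ij}$ in column $i$ from the left, row $j$ from the bottom). An $M$-gridding of a permutation is a division of its plot by $m-1$ vertical and $n-1$ horizontal lines into cells, each point interior to a cell, with cell $ij$ empty if $M_{ij}=0$, increasing if $M_{ij}=1$, decreasing if $M_{ij}=-1$. The row-column graph $G_M$ is the bipartite graph on columns $1,\dots,m$ and rows $1',\dots,n'$ with edge $ij'$ iff $M_{ij}\neq0$; $M$ is cyclic if $G_M$ is isomorphic to a cycle. A partial multiplication matrix is a gridding matrix with fixed $c_i,r_j\in\{\pm1\}$ such that $M_{ij}=c_ir_j$ whenever $M_{ij}\ne 0$; column $i$ is oriented left-to-right if $c_i=1$ and right-to-left otherwise, row $j$ bottom-to-top if $r_j=1$ and top-to-bottom otherwise. For an $M$-gridded permutation $\pi^\#$, the orientation digraph $D_{\pi^\#}$ has an arc $x\to y$ between points whenever they share a column (resp. row) and $x$ precedes $y$ in its orientation. With $\ell$ the length of the cycle $G_M$, a gridded $M$-coil is an $M$-gridded permutation with $n>\ell$ points, an ordering $v_1,\dots,v_n$ of its points and a labelling of the $\ell$ nonzero cells by $1,\dots,\ell$ such that (C1)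 $v_i$ lies in cell $i\bmod\ell$ (residues in $\{1,\dots,\ell\}$); (C2) $v_{i-1}\to v_i$ for $1<i\le n$; (C3) $v_i\to v_{i-\ell-1}$ for $\ell+1<i\le n$; (C4) $v_{\ell+1}\to v_1$. Its length is $n$. An $M$-coil is a permutation with some $M$-gridding that is a gridded $M$-coil. A quasi-order is well quasi-ordered (wqo) if every infinite sequence $x_1,x_2,\dots$ has $i<j$ with $x_i\le x_j$. For a quasi-order $(L,\le_L)$, an $L$-labelled permutation is $(\pi,\lambda)$ with $\lambda$ a map from the points of $\pi$ to $L$; $(\sigma,\mu)\le(\pi,\lambda)$ if some embedding of $\sigma$ into $\pi$ sends each point $p$ to a point $q$ with $\mu(p)\le_L\lambda(q)$. A set of permutations is labelled well quasi-ordered if, for every wqo $L$, its $L$-labelled permutations form a wqo. -}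

module Defs where

open import Data.Nat using (ℕ; zero; suc; _+_; _*_; _≤_; _<_)
open import Data.Fin using (Fin; toℕ)
open import Data.Product using (Σ; ∃; _×_; _,_; proj₁; proj₂)
open import Data.Sum using (_⊎_)
open import Data.Empty using (⊥)
open import Relation.Nullary using (¬_)
open import Relation.Binary.PropositionalEquality using (_≡_; _≢_)
open import Relation.Binary using (Reflexive; Transitive)
open import Function.Definitions using (Injective; Bijective)
open import Function.Bundles using (_⇔_)

record Perm (N : ℕ) : Set where
  field
    fun : Fin N → Fin N
    inj : Injective _≡_ _≡_ fun
open Perm public

_<ᶠ_ : ∀ {N} → Fin N → Fin N → Set
a <ᶠ b = toℕ a < toℕ b

_≤ᶠ_ : ∀ {N} → Fin N → Fin N → Set
a ≤ᶠ b = toℕ a ≤ toℕ b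

record Embedding {k N : ℕ} (σ : Perm k) (π : Perm N) : Set where
  field
    map     : Fin k → Fin N
    mono    : ∀ x y → x <ᶠ y → map x <ᶠ map y
    orderIso : ∀ x y → (fun σ x <ᶠ fun σ y) ⇔ (fun π (map x) <ᶠ fun π (map y))
open Embedding public

_≼_ : ∀ {k N} → Perm k → Perm N → Set
σ ≼ π = Embedding σ π

PermSet : Set₁
PermSet = ∀ {N} → Perm N → Set

IsPermClass : PermSet → Set
IsPermClass C = ∀ {k N} (σ : Perm k) (π : Perm N) → σ ≼ π → C π → C σ

record IsQuasiOrder {A : Set} (_≤_ : A → A → Set) : Set where
  field
    refl  : Reflexive _≤_
    trans : Transitive _≤_

IsWqo : {A : Set} → (A → A → Set) → Set
IsWqo {A} _≤_ = (x : ℕ → A) → ∃ λ i → ∃ λ j → i < j × x i ≤ x j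

LabelledIn : PermSet → Set → Set
LabelledIn C L = Σ ℕ λ N → Σ (Perm N) λ π → C π × (Fin N → L)

labelledOrder : (C : PermSet) {L : Set} → (L → L → Set) →
                LabelledIn C L → LabelledIn C L → Set
labelledOrder C _≤L_ (k , σ , _ , μ) (N , π , _ , λ′) =
  Σ (Embedding σ π) λ e → ∀ p → μ p ≤L λ′ (map e p)

IsLabelledWqo : PermSet → Set₁
IsLabelledWqo C = (L : Set) (_≤L_ : L → L → Set) →
  IsQuasiOrder _≤L_ → IsWqo _≤L_ → IsWqo (labelledOrder C _≤L_)

data Entry : Set where
  zer pos neg : Entry

data Sign : Set where
  plus minus : Sign

_·ˢ_ : Sign → Sign → Sign
plus  ·ˢ s = s
minus ·ˢ plus = minus
minus ·ˢ minus = plus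

toEntry : Sign → Entry
toEntry plus  = pos
toEntry minus = neg

-- m columns, n rows; M i j is column i (from left), row j (from bottom)
GriddingMatrix : ℕ → ℕ → Set
GriddingMatrix m n = Fin m → Fin n → Entry

record PMM (m n : ℕ) : Set where
  field
    mat  : GriddingMatrix m n
    c    : Fin m → Sign
    r    : Fin n → Sign
    mult : ∀ i j → mat i j ≢ zer → mat i j ≡ toEntry (c i ·ˢ r j)
open PMM public

RCAdj : ∀ {m n} → GriddingMatrix m n → (Fin m ⊎ Fin n) → (Fin m ⊎ Fin n) → Set
RCAdj M (Data.Sum.inj₁ i) (Data.Sum.inj₂ j) = M i j ≢ zer
RCAdj M (Data.Sum.inj₂ j) (Data.Sum.inj₁ i) = M i j ≢ zer
RCAdj M (Data.Sum.inj₁ _) (Data.Sum.inj₁ _) = ⊥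
RCAdj M (Data.Sum.inj₂ _) (Data.Sum.inj₂ _) = ⊥

CycSucc : ∀ k → Fin k → Fin k → Set
CycSucc k i j = (toℕ j ≡ suc (toℕ i)) ⊎ (suc (toℕ i) ≡ k × toℕ j ≡ 0)

CycAdj : ∀ k → Fin k → Fin k → Set
CycAdj k i j = CycSucc k i j ⊎ CycSucc k j i

IsCyclic : ∀ {m n} → GriddingMatrix m n → Set
IsCyclic {m} {n} M = Σ ℕ λ k → 3 ≤ k × Σ (Fin m ⊎ Fin n → Fin k) λ f →
  Bijective _≡_ _≡_ f × (∀ u v → RCAdj M u v ⇔ CycAdj k (f u) (f v))

-- An M-gridding of π: the column of a point is a weakly increasing
-- function of its position, the row a weakly increasing function of its
-- value (this is exactly a division by m-1 vertical and n-1 horizontal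
-- lines avoiding the points); cell conditions as in the paper.
record Gridding {m n N : ℕ} (M : GriddingMatrix m n) (π : Perm N) : Set where
  field
    col    : Fin N → Fin m
    row    : Fin N → Fin n
    colMon : ∀ x y → x ≤ᶠ y → col x ≤ᶠ col y
    rowMon : ∀ x y → fun π x ≤ᶠ fun π y → row x ≤ᶠ row y
    nonEmpty : ∀ x → M (col x) (row x) ≢ zer
    incr : ∀ x y → M (col x) (row x) ≡ pos → col x ≡ col y → row x ≡ row y →
           x <ᶠ y → fun π x <ᶠ fun π y
    decr : ∀ x y → M (col x) (row x) ≡ neg → col x ≡ col y → row x ≡ row y →
           x <ᶠ y → fun π y <ᶠ fun π x
open Gridding public

cellOf : ∀ {m n N} {M : GriddingMatrix m n} {π : Perm N} →
         Gridding M π → Fin N → Fin m × Fin n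
cellOf g x = col g x , row g x

Before : ∀ {K} → Sign → Fin K → Fin K → Set
Before plus  a b = a <ᶠ b
Before minus a b = b <ᶠ a

Arc : ∀ {m n N} (M : PMM m n) {π : Perm N} → Gridding (mat M) π →
      Fin N → Fin N → Set
Arc M {π} g x y =
  (col g x ≡ col g y × Before (c M (col g x)) x y) ⊎
  (row g x ≡ row g y × Before (r M (row g x)) (fun π x) (fun π y))

-- Coils (0-indexed: v_i of the paper is v (i-1); cells labelled by Fin ℓ)
-- ℓ = m + n is the length of the cycle G_M (number of its vertices = edges).

record GriddedCoil {m n N : ℕ} (M : PMM m n) (π : Perm N)
                   (g : Gridding (mat M) π) : Set where
  ℓ : ℕ
  ℓ = m + n
  field
    long   : ℓ < N
    v      : Fin N → Fin N
    vBij   : Bijective _≡_ _≡_ v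
    lab    : Fin ℓ → Fin m × Fin n
    labInj : Injective _≡_ _≡_ lab
    labNZ  : ∀ k → mat M (proj₁ (lab k)) (proj₂ (lab k)) ≢ zer
    labSur : ∀ i j → mat M i j ≢ zer → ∃ λ k → lab k ≡ (i , j)
    C1 : ∀ (i : Fin N) (k : Fin ℓ) q → toℕ i ≡ q * ℓ + toℕ k →
         cellOf g (v i) ≡ lab k
    C2 : ∀ (i j : Fin N) → toℕ j ≡ suc (toℕ i) → Arc M g (v i) (v j)
    C3 : ∀ (i j : Fin N) → toℕ i ≡ toℕ j + ℓ + 1 → Arc M g (v i) (v j)
    C4 : ∀ (i j : Fin N) → toℕ i ≡ ℓ → toℕ j ≡ 0 → Arc M g (v i) (v j)

IsCoil : ∀ {m n N} → PMM m n → Perm N → Set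
IsCoil M π = Σ (Gridding (mat M) π) λ g → GriddedCoil M π g

-- Label each point of a gridded M-coil by its cell, its index modulo ℓ, and whether it is the
-- first or the last point; these labels range over a finite, hence well quasi-ordered, set.
-- A label-preserving embedding of one coil into another sends v₀ to v₀ and then, inductively,
-- vₖ to vₖ. The image of vₖ₊₁ has the residue of k + 1; it cannot be an earlier point, by
-- injectivity, nor a later one v_{k+1+(s+1)ℓ}: the arcs (C3) and (C2) form a zigzag
-- v_{k+1+(s+1)ℓ} → v_{k+sℓ} → v_{k+1+sℓ} → ⋯ → vₖ inside the two cells of vₖ and vₖ₊₁, which share
-- a column or a row, and arcs between distinct cells of one line follow that line's orientation,
-- a strict order, which the image of the arc vₖ → vₖ₊₁ would then close into a cycle.
-- So the last point of the shorter coil is the last point of the longer one, and coils of distinct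
-- lengths form an antichain.

module Submission where

open import Defs
open import Data.Bool using (Bool; T)
open import Data.Empty using (⊥-elim)
open import Data.Fin using (Fin; toℕ; fromℕ<)
open import Data.Fin.Properties
  using (toℕ-fromℕ<; toℕ-injective; toℕ<n; pigeonhole; 2↔Bool; *↔×)
open import Data.Nat
  using (ℕ; zero; suc; _+_; _*_; _≤_; _<_; _≡ᵇ_; z≤n; s≤s; z<s; s≤s⁻¹; NonZero; >-nonZero)
open import Data.Nat.DivMod using (_%_; _/_; _mod_; m≡m%n+[m/n]*n; [m+kn]%n≡m%n; m%n<n)
open import Data.Nat.Induction using (<-rec)
open import Data.Nat.Properties
open import Data.Nat.Tactic.RingSolver using (solve-∀)
open import Data.Product using (Σ; ∃; _×_; _,_; proj₁; proj₂)
open import Data.Product.Function.NonDependent.Propositional using (_×-↣_)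
open import Data.Sum using (_⊎_; inj₁; inj₂)
open import Function using (_∘_; id)
open import Function.Bundles using (_↣_; Injection; Equivalence)
open import Function.Construct.Composition using (_↣-∘_)
open import Function.Construct.Identity using (↣-id)
open import Function.Definitions using (Injective)
open import Function.Properties.Inverse using (↔⇒↣; ↔-sym)
open import Relation.Binary.Definitions using (tri<; tri≈; tri>)
open import Relation.Binary.PropositionalEquality
open import Relation.Nullary using (¬_)
open import Relation.Nullary.Decidable using (yes; no)

Finite : Set → Set
Finite A = ∃ λ k → A ↣ Fin k

Fin-finite : ∀ {k} → Finite (Fin k)
Fin-finite {k} = k , ↣-id (Fin k)

Bool-finite : Finite Bool
Bool-finite = 2 , ↔⇒↣ (↔-sym 2↔Bool)

×-finite : ∀ {A B} → Finite A → Finite B → Finite (A × B)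
×-finite (k , f) (l , g) = k * l , ↔⇒↣ (↔-sym *↔×) ↣-∘ (f ×-↣ g)

≡-isQuasiOrder : {A : Set} → IsQuasiOrder (_≡_ {A = A})
≡-isQuasiOrder = record { refl = refl ; trans = trans }

≡-isWqo : {A : Set} → Finite A → IsWqo (_≡_ {A = A})
≡-isWqo (k , f) x with pigeonhole (n<1+n k) (Injection.to f ∘ x ∘ toℕ)
... | i , j , i<j , fxi≡fxj = toℕ i , toℕ j , i<j , Injection.injective f fxi≡fxj

antichain⇒¬IsLabelledWqo : ∀ {C : PermSet} {L : Set} → Finite L →
  (x : ℕ → LabelledIn C L) → (∀ {i j} → i < j → ¬ labelledOrder C _≡_ (x i) (x j)) →
  ¬ IsLabelledWqo C
antichain⇒¬IsLabelledWqo {L = L} fin x antichain lwqo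
  with lwqo L _≡_ ≡-isQuasiOrder (≡-isWqo fin) x
... | i , j , i<j , xi≤xj = antichain i<j xi≤xj

unbounded⇒increasing : {P : ℕ → Set} → (∀ K → Σ ℕ λ N → K ≤ N × P N) →
  Σ (ℕ → ℕ) λ f → (∀ {i j} → i < j → f i < f j) × (∀ s → P (f s))
unbounded⇒increasing {P} unbounded = f , f-mono , P-f
  where
  f : ℕ → ℕ
  f zero    = proj₁ (unbounded 0)
  f (suc s) = proj₁ (unbounded (suc (f s)))

  P-f : ∀ s → P (f s)
  P-f zero    = proj₂ (proj₂ (unbounded 0))
  P-f (suc s) = proj₂ (proj₂ (unbounded (suc (f s))))

  f-step : ∀ s → f s < f (suc s)
  f-step s = proj₁ (proj₂ (unbounded (suc (f s))))

  f-mono : ∀ {i j} → i < j → f i < f j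
  f-mono {i} {suc j} i<1+j with m≤n⇒m<n∨m≡n (s≤s⁻¹ i<1+j)
  ... | inj₁ i<j  = <-trans (f-mono i<j) (f-step j)
  ... | inj₂ refl = f-step j

≡ᵇ-transfer : ∀ {a b c d} → (a ≡ᵇ c) ≡ (b ≡ᵇ d) → a ≡ c → b ≡ d
≡ᵇ-transfer {a} {b} {c} {d} tests a≡c = ≡ᵇ⇒≡ b d (subst T tests (≡⇒≡ᵇ a c a≡c))

module _ {d : ℕ} .{{_ : NonZero d}} where

  toℕ-mod : ∀ k → toℕ (k mod d) ≡ k % d
  toℕ-mod k = toℕ-fromℕ< (m%n<n k d)

  %-≡⇒mod-≡ : ∀ {i j} → i % d ≡ j % d → i mod d ≡ j mod d
  %-≡⇒mod-≡ {i} {j} eq = toℕ-injective (trans (toℕ-mod i) (trans eq (sym (toℕ-mod j))))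

  mod-≡⇒%-≡ : ∀ {i j} → i mod d ≡ j mod d → i % d ≡ j % d
  mod-≡⇒%-≡ {i} {j} eq = trans (sym (toℕ-mod i)) (trans (cong toℕ eq) (toℕ-mod j))

  %-≡⇒≡+* : ∀ {a b} → b < a → a % d ≡ b % d → ∃ λ s → a ≡ b + suc s * d
  %-≡⇒≡+* {a} {b} b<a a≡b with a / d ≤? b / d
  ... | yes qa≤qb = ⊥-elim (<⇒≱ b<a (begin
    a                   ≡⟨ m≡m%n+[m/n]*n a d ⟩
    a % d + (a / d) * d ≤⟨ +-mono-≤ (≤-reflexive a≡b) (*-monoˡ-≤ d qa≤qb) ⟩
    b % d + (b / d) * d ≡⟨ m≡m%n+[m/n]*n b d ⟨
    b                   ∎))
    where open ≤-Reasoning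
  ... | no qa≰qb with m≤n⇒∃[o]m+o≡n (≰⇒> qa≰qb)
  ...   | s , qb+1+s≡qa = s , (begin
    a                             ≡⟨ m≡m%n+[m/n]*n a d ⟩
    a % d + (a / d) * d           ≡⟨ cong₂ _+_ a≡b (cong (_* d) (sym qb+1+s≡qa)) ⟩
    b % d + (suc (b / d) + s) * d ≡⟨ regroup (b % d) (b / d) s d ⟩
    (b % d + (b / d) * d) + suc s * d ≡⟨ cong (_+ suc s * d) (m≡m%n+[m/n]*n b d) ⟨
    b + suc s * d                 ∎)
    where
    open ≡-Reasoning
    regroup : ∀ r q s d → r + (suc q + s) * d ≡ (r + q * d) + suc s * d
    regroup = solve-∀

  %-suc-≢ : 2 ≤ d → ∀ i → i % d ≢ suc i % d
  %-suc-≢ 2≤d i eq with %-≡⇒≡+* (n<1+n i) (sym eq)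
  ... | s , 1+i≡i+[1+s]d = <⇒≱ 2≤d (begin
    d             ≤⟨ m≤m+n d (s * d) ⟩
    suc s * d     ≡⟨ +-cancelˡ-≡ i _ _ (trans (sym 1+i≡i+[1+s]d) (sym (+-comm i 1))) ⟩
    1             ∎)
    where open ≤-Reasoning

Before-trans : ∀ {K} s {a b c : Fin K} → Before s a b → Before s b c → Before s a c
Before-trans plus  a<b b<c = <-trans a<b b<c
Before-trans minus b<a c<b = <-trans c<b b<a

Before-irrefl : ∀ {K} s {a : Fin K} → ¬ Before s a a
Before-irrefl plus  = <-irrefl refl
Before-irrefl minus = <-irrefl refl

Before-mono : ∀ {A : Set} {K K′} (f : A → Fin K) (g : A → Fin K′) →
  (∀ a b → f a <ᶠ f b → g a <ᶠ g b) →
  ∀ s {a b} → Before s (f a) (f b) → Before s (g a) (g b)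
Before-mono f g mono plus  = mono _ _
Before-mono f g mono minus = mono _ _

embedding-injective : ∀ {k N} {σ : Perm k} {π : Perm N} (e : σ ≼ π) →
  Injective _≡_ _≡_ (map e)
embedding-injective e {x} {y} ex≡ey with <-cmp (toℕ x) (toℕ y)
... | tri< x<y _ _ = ⊥-elim (<-irrefl (cong toℕ ex≡ey) (mono e x y x<y))
... | tri≈ _ x≡y _ = toℕ-injective x≡y
... | tri> _ _ y<x = ⊥-elim (<-irrefl (cong toℕ (sym ex≡ey)) (mono e y x y<x))

data Line (m n : ℕ) : Set where
  columnLine : Fin m → Line m n
  rowLine    : Fin n → Line m n

module Orientation {m n N} (M : PMM m n) {π : Perm N} (g : Gridding (mat M) π) where

  _∈ᴸ_ : Fin N → Line m n → Set
  x ∈ᴸ columnLine i = col g x ≡ i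
  x ∈ᴸ rowLine j    = row g x ≡ j

  _≺⟨_⟩_ : Fin N → Line m n → Fin N → Set
  x ≺⟨ columnLine i ⟩ y = Before (c M i) x y
  x ≺⟨ rowLine j ⟩ y    = Before (r M j) (fun π x) (fun π y)

  ≺-trans : ∀ L {x y z} → x ≺⟨ L ⟩ y → y ≺⟨ L ⟩ z → x ≺⟨ L ⟩ z
  ≺-trans (columnLine i) = Before-trans (c M i)
  ≺-trans (rowLine j)    = Before-trans (r M j)

  ≺-irrefl : ∀ L {x} → ¬ x ≺⟨ L ⟩ x
  ≺-irrefl (columnLine i) = Before-irrefl (c M i)
  ≺-irrefl (rowLine j)    = Before-irrefl (r M j)

  ∈ᴸ-cell : ∀ L {x y} → cellOf g x ≡ cellOf g y → x ∈ᴸ L → y ∈ᴸ L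
  ∈ᴸ-cell (columnLine i) x≈y x∈L = trans (cong proj₁ (sym x≈y)) x∈L
  ∈ᴸ-cell (rowLine j)    x≈y x∈L = trans (cong proj₂ (sym x≈y)) x∈L

  arc⇒line : ∀ {x y} → Arc M g x y → Σ (Line m n) λ L → x ∈ᴸ L × y ∈ᴸ L
  arc⇒line {x} (inj₁ (same-col , _)) = columnLine (col g x) , refl , sym same-col
  arc⇒line {x} (inj₂ (same-row , _)) = rowLine (row g x) , refl , sym same-row

  arc⇒≺ : ∀ L {x y} → x ∈ᴸ L → y ∈ᴸ L → cellOf g x ≢ cellOf g y →
    Arc M g x y → x ≺⟨ L ⟩ y
  arc⇒≺ (columnLine i) {x} {y} x∈L _ _ (inj₁ (_ , x≺y)) =
    subst (λ k → Before (c M k) x y) x∈L x≺y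
  arc⇒≺ (columnLine i) x∈L y∈L x≉y (inj₂ (same-row , _)) =
    ⊥-elim (x≉y (cong₂ _,_ (trans x∈L (sym y∈L)) same-row))
  arc⇒≺ (rowLine j) {x} {y} x∈L _ _ (inj₂ (_ , x≺y)) =
    subst (λ k → Before (r M k) (fun π x) (fun π y)) x∈L x≺y
  arc⇒≺ (rowLine j) x∈L y∈L x≉y (inj₁ (same-col , _)) =
    ⊥-elim (x≉y (cong₂ _,_ same-col (trans x∈L (sym y∈L))))

arc-embed : ∀ {m n k N} {M : PMM m n} {σ : Perm k} {π : Perm N}
  {gσ : Gridding (mat M) σ} {gπ : Gridding (mat M) π} (e : σ ≼ π) →
  (∀ x → cellOf gπ (map e x) ≡ cellOf gσ x) →
  ∀ {x y} → Arc M gσ x y → Arc M gπ (map e x) (map e y)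
arc-embed {M = M} {σ} {π} {gσ} {gπ} e cell-pres {x} {y} (inj₁ (same-col , x≺y)) =
  inj₁ (trans (col-pres x) (trans same-col (sym (col-pres y))) ,
        subst (λ i → Before (c M i) (map e x) (map e y)) (sym (col-pres x))
              (Before-mono id (map e) (mono e) _ x≺y))
  where
  col-pres : ∀ x → col gπ (map e x) ≡ col gσ x
  col-pres = cong proj₁ ∘ cell-pres
arc-embed {M = M} {σ} {π} {gσ} {gπ} e cell-pres {x} {y} (inj₂ (same-row , x≺y)) =
  inj₂ (trans (row-pres x) (trans same-row (sym (row-pres y))) ,
        subst (λ j → Before (r M j) (fun π (map e x)) (fun π (map e y))) (sym (row-pres x))
              (Before-mono (fun σ) (fun π ∘ map e) (λ a b → Equivalence.to (orderIso e a b))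
                           _ x≺y))
  where
  row-pres : ∀ x → row gπ (map e x) ≡ row gσ x
  row-pres = cong proj₂ ∘ cell-pres

Label : ℕ → ℕ → Set
Label m n = Fin (m + n) × (Fin m × Fin n) × Bool × Bool

Label-finite : ∀ m n → Finite (Label m n)
Label-finite m n =
  ×-finite Fin-finite (×-finite (×-finite Fin-finite Fin-finite) (×-finite Bool-finite Bool-finite))

module Coil {m n N} {M : PMM m n} {π : Perm N} {g : Gridding (mat M) π}
            (coil : GriddedCoil M π g) where
  open GriddedCoil coil
  open Orientation M g

  2≤ℓ : 2 ≤ ℓ
  2≤ℓ = +-mono-≤ (inhabited (col g x)) (inhabited (row g x))
    where
    x : Fin N
    x = v (fromℕ< (≤-<-trans z≤n long))
    inhabited : ∀ {k} → Fin k → 0 < k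
    inhabited i = ≤-<-trans z≤n (toℕ<n i)

  instance
    ℓ-nonZero : NonZero ℓ
    ℓ-nonZero = >-nonZero (<-trans z<s 2≤ℓ)

  residue : ℕ → Fin ℓ
  residue k = k mod ℓ

  point : (k : ℕ) → .(k < N) → Fin N
  point k k<N = v (fromℕ< k<N)

  index : Fin N → Fin N
  index x = proj₁ (proj₂ vBij x)

  v-index : ∀ x → v (index x) ≡ x
  v-index x = proj₂ (proj₂ vBij x) refl

  position : Fin N → ℕ
  position = toℕ ∘ index

  position<N : ∀ x → position x < N
  position<N = toℕ<n ∘ index

  position-point : ∀ k .(k<N : k < N) → position (point k k<N) ≡ k
  position-point k k<N = trans (cong toℕ (proj₁ vBij (v-index (point k k<N)))) (toℕ-fromℕ< k<N)

  position⇒point : ∀ {x k} .(k<N : k < N) → position x ≡ k → x ≡ point k k<N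
  position⇒point {x} k<N position≡k =
    trans (sym (v-index x)) (cong v (toℕ-injective (trans position≡k (sym (toℕ-fromℕ< k<N)))))

  position-injective : ∀ {x y} → position x ≡ position y → x ≡ y
  position-injective {x} {y} eq = trans (sym (v-index x)) (trans (cong v (toℕ-injective eq)) (v-index y))

  cell-point : ∀ k .(k<N : k < N) → cellOf g (point k k<N) ≡ lab (residue k)
  cell-point k k<N = C1 (fromℕ< k<N) (residue k) (k / ℓ) (begin
    toℕ (fromℕ< k<N)            ≡⟨ toℕ-fromℕ< k<N ⟩
    k                           ≡⟨ m≡m%n+[m/n]*n k ℓ ⟩
    k % ℓ + (k / ℓ) * ℓ         ≡⟨ +-comm (k % ℓ) _ ⟩
    (k / ℓ) * ℓ + k % ℓ         ≡⟨ cong ((k / ℓ) * ℓ +_) (toℕ-mod k) ⟨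
    (k / ℓ) * ℓ + toℕ (residue k) ∎)
    where open ≡-Reasoning

  same-cell : ∀ {i j} .(i<N : i < N) .(j<N : j < N) → i % ℓ ≡ j % ℓ →
    cellOf g (point i i<N) ≡ cellOf g (point j j<N)
  same-cell {i} {j} i<N j<N i≡j =
    trans (cell-point i i<N) (trans (cong lab (%-≡⇒mod-≡ i≡j)) (sym (cell-point j j<N)))

  different-cells : ∀ {i j} .(i<N : i < N) .(j<N : j < N) → i % ℓ ≢ j % ℓ →
    cellOf g (point i i<N) ≢ cellOf g (point j j<N)
  different-cells {i} {j} i<N j<N i≢j same =
    i≢j (mod-≡⇒%-≡ (labInj (trans (sym (cell-point i i<N)) (trans same (cell-point j j<N)))))

  arc-next : ∀ k .(1+k<N : suc k < N) →
    Arc M g (point k (<-trans (n<1+n k) 1+k<N)) (point (suc k) 1+k<N)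
  arc-next k 1+k<N = C2 (fromℕ< _) (fromℕ< 1+k<N)
    (trans (toℕ-fromℕ< 1+k<N) (cong suc (sym (toℕ-fromℕ< _))))

  arc-back : ∀ {i j} .(i<N : i < N) .(j<N : j < N) → i ≡ j + ℓ + 1 →
    Arc M g (point i i<N) (point j j<N)
  arc-back {i} {j} i<N j<N i≡j+ℓ+1 = C3 (fromℕ< i<N) (fromℕ< j<N)
    (trans (toℕ-fromℕ< i<N) (trans i≡j+ℓ+1 (cong (λ k → k + ℓ + 1) (sym (toℕ-fromℕ< j<N)))))

  residue-periodic : ∀ k t → (k + t * ℓ) % ℓ ≡ k % ℓ
  residue-periodic k t = [m+kn]%n≡m%n k t ℓ

  module Zigzag (a : ℕ) (1+a<N : suc a < N) where

    a<N : a < N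
    a<N = <-trans (n<1+n a) 1+a<N

    line : Σ (Line m n) λ L → point a a<N ∈ᴸ L × point (suc a) 1+a<N ∈ᴸ L
    line = arc⇒line (arc-next a 1+a<N)

    L : Line m n
    L = proj₁ line

    on-L : ∀ {k} .(k<N : k < N) → k % ℓ ≡ a % ℓ ⊎ k % ℓ ≡ suc a % ℓ →
      point k k<N ∈ᴸ L
    on-L k<N (inj₁ k≡a)   = ∈ᴸ-cell L (same-cell a<N k<N (sym k≡a)) (proj₁ (proj₂ line))
    on-L k<N (inj₂ k≡1+a) = ∈ᴸ-cell L (same-cell 1+a<N k<N (sym k≡1+a)) (proj₂ (proj₂ line))

    ≺-forward : ∀ {i j} .(i<N : i < N) .(j<N : j < N) →
      i % ℓ ≡ a % ℓ → j % ℓ ≡ suc a % ℓ →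
      Arc M g (point i i<N) (point j j<N) → point i i<N ≺⟨ L ⟩ point j j<N
    ≺-forward i<N j<N i≡a j≡1+a = arc⇒≺ L (on-L i<N (inj₁ i≡a)) (on-L j<N (inj₂ j≡1+a))
      (different-cells i<N j<N λ i≡j →
        %-suc-≢ 2≤ℓ a (trans (sym i≡a) (trans i≡j j≡1+a)))

    ≺-backward : ∀ {i j} .(i<N : i < N) .(j<N : j < N) →
      i % ℓ ≡ suc a % ℓ → j % ℓ ≡ a % ℓ →
      Arc M g (point i i<N) (point j j<N) → point i i<N ≺⟨ L ⟩ point j j<N
    ≺-backward i<N j<N i≡1+a j≡a = arc⇒≺ L (on-L i<N (inj₂ i≡1+a)) (on-L j<N (inj₁ j≡a))
      (different-cells i<N j<N λ i≡j →
        %-suc-≢ 2≤ℓ a (trans (sym j≡a) (trans (sym i≡j) i≡1+a)))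

    zigzag : ∀ s (h : suc a + suc s * ℓ < N) → point (suc a + suc s * ℓ) h ≺⟨ L ⟩ point a a<N
    zigzag zero h =
      ≺-backward h a<N (residue-periodic (suc a) 1) refl (arc-back h a<N (first-lap a ℓ))
      where
      first-lap : ∀ a ℓ → suc a + 1 * ℓ ≡ a + ℓ + 1
      first-lap = solve-∀
    zigzag (suc s) h =
      ≺-trans L (≺-backward h k<N (residue-periodic (suc a) (suc (suc s))) (residue-periodic a (suc s))
                            (arc-back h k<N (next-lap a s ℓ)))
      (≺-trans L (≺-forward k<N 1+k<N (residue-periodic a (suc s)) (residue-periodic (suc a) (suc s))
                            (arc-next k 1+k<N))
                 (zigzag s 1+k<N))
      where
      k : ℕ
      k = a + suc s * ℓ
      1+k<N : suc k < N
      1+k<N = ≤-<-trans (s≤s (+-monoʳ-≤ a (*-monoˡ-≤ ℓ (n≤1+n (suc s))))) h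
      k<N : k < N
      k<N = <-trans (n<1+n k) 1+k<N
      next-lap : ∀ a s ℓ → suc a + suc (suc s) * ℓ ≡ (a + suc s * ℓ) + ℓ + 1
      next-lap = solve-∀

  no-shortcut : ∀ {x y} → suc (position x) < position y →
    residue (position y) ≡ residue (suc (position x)) → ¬ Arc M g x y
  no-shortcut {x} {y} 1+a<b b≡1+a x→y with %-≡⇒≡+* 1+a<b (mod-≡⇒%-≡ b≡1+a)
  ... | s , b≡1+a+[1+s]ℓ =
    ≺-irrefl L (≺-trans L (≺-forward a<N b<N refl (residue-periodic (suc a) (suc s)) x→y′)
                          (zigzag s b<N))
    where
    a : ℕ
    a = position x
    open Zigzag a (<-trans 1+a<b (position<N y))
    b<N : suc a + suc s * ℓ < N
    b<N = subst (_< N) b≡1+a+[1+s]ℓ (position<N y)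
    x→y′ : Arc M g (point a a<N) (point (suc a + suc s * ℓ) b<N)
    x→y′ = subst₂ (Arc M g) (position⇒point a<N refl) (position⇒point b<N b≡1+a+[1+s]ℓ) x→y

  label : Fin N → Label m n
  label x = residue (position x) , cellOf g x , (position x ≡ᵇ 0) , (suc (position x) ≡ᵇ N)

  last-index : ∃ λ j → suc j ≡ N
  last-index = let (o , 1+ℓ+o≡N) = m≤n⇒∃[o]m+o≡n long in ℓ + o , 1+ℓ+o≡N

module LabelPreservingEmbedding {m n NA NB} {M : PMM m n}
  {πA : Perm NA} {gA : Gridding (mat M) πA} {πB : Perm NB} {gB : Gridding (mat M) πB}
  (coilA : GriddedCoil M πA gA) (coilB : GriddedCoil M πB gB) (e : πA ≼ πB)
  (label-pres : ∀ x → Coil.label coilA x ≡ Coil.label coilB (map e x)) where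

  module A = Coil coilA
  module B = Coil coilB

  residue-pres : ∀ x → B.residue (B.position (map e x)) ≡ A.residue (A.position x)
  residue-pres x = sym (cong proj₁ (label-pres x))

  cell-pres : ∀ x → cellOf gB (map e x) ≡ cellOf gA x
  cell-pres x = sym (cong (proj₁ ∘ proj₂) (label-pres x))

  first-pres : ∀ x → A.position x ≡ 0 → B.position (map e x) ≡ 0
  first-pres x = ≡ᵇ-transfer (cong (proj₁ ∘ proj₂ ∘ proj₂) (label-pres x))

  last-pres : ∀ x → suc (A.position x) ≡ NA → suc (B.position (map e x)) ≡ NB
  last-pres x = ≡ᵇ-transfer (cong (proj₂ ∘ proj₂ ∘ proj₂) (label-pres x))

  PositionPreserved : ℕ → Set
  PositionPreserved k = (k<NA : k < NA) → B.position (map e (A.point k k<NA)) ≡ k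

  image-position-injective : ∀ {i k} (i<NA : i < NA) (k<NA : k < NA) →
    B.position (map e (A.point i i<NA)) ≡ B.position (map e (A.point k k<NA)) → i ≡ k
  image-position-injective {i} {k} i<NA k<NA same-position = begin
    i                           ≡⟨ A.position-point i i<NA ⟨
    A.position (A.point i i<NA) ≡⟨ cong A.position (embedding-injective e
                                     (B.position-injective same-position)) ⟩
    A.position (A.point k k<NA) ≡⟨ A.position-point k k<NA ⟩
    k                           ∎
    where open ≡-Reasoning

  no-skip : ∀ j (1+j<NA : suc j < NA) → PositionPreserved j →
    ¬ suc j < B.position (map e (A.point (suc j) 1+j<NA))
  no-skip j 1+j<NA pres-j 1+j<p =
    B.no-shortcut (subst (λ k → suc k < p) (sym x↦j) 1+j<p) p≡1+j
      (arc-embed {M = M} {gσ = gA} {gπ = gB} e cell-pres (A.arc-next j 1+j<NA))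
    where
    open ≡-Reasoning
    j<NA : j < NA
    j<NA = <-trans (n<1+n j) 1+j<NA
    x↦j : B.position (map e (A.point j j<NA)) ≡ j
    x↦j = pres-j j<NA
    y : Fin NA
    y = A.point (suc j) 1+j<NA
    p : ℕ
    p = B.position (map e y)
    p≡1+j : B.residue p ≡ B.residue (suc (B.position (map e (A.point j j<NA))))
    p≡1+j = begin
      B.residue p                    ≡⟨ residue-pres y ⟩
      A.residue (A.position y)       ≡⟨ cong A.residue (A.position-point (suc j) 1+j<NA) ⟩
      A.residue (suc j)              ≡⟨ cong (A.residue ∘ suc) x↦j ⟨
      B.residue (suc (B.position (map e (A.point j j<NA)))) ∎

  position-pres-suc : ∀ j → (∀ {i} → i < suc j → PositionPreserved i) →
    PositionPreserved (suc j)
  position-pres-suc j earlier 1+j<NA with <-cmp (B.position (map e (A.point (suc j) 1+j<NA))) (suc j)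
  ... | tri< p<1+j _ _ = ⊥-elim (<⇒≢ p<1+j
    (image-position-injective p<NA 1+j<NA (earlier p<1+j p<NA)))
    where
    p<NA : B.position (map e (A.point (suc j) 1+j<NA)) < NA
    p<NA = <-trans p<1+j 1+j<NA
  ... | tri≈ _ p≡1+j _ = p≡1+j
  ... | tri> _ _ 1+j<p = ⊥-elim (no-skip j 1+j<NA (earlier (n<1+n j)) 1+j<p)

  position-pres : ∀ k → PositionPreserved k
  position-pres = <-rec PositionPreserved step
    where
    step : ∀ k → (∀ {i} → i < k → PositionPreserved i) → PositionPreserved k
    step zero    _       0<NA = first-pres (A.point 0 0<NA) (A.position-point 0 0<NA)
    step (suc j) earlier      = position-pres-suc j earlier

  same-length : NA ≡ NB
  same-length = begin
    NA                            ≡⟨ 1+j≡NA ⟨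
    suc j                         ≡⟨ cong suc (position-pres j j<NA) ⟨
    suc (B.position (map e x))    ≡⟨ last-pres x (trans (cong suc (A.position-point j j<NA)) 1+j≡NA) ⟩
    NB                            ∎
    where
    open ≡-Reasoning
    j : ℕ
    j = proj₁ A.last-index
    1+j≡NA : suc j ≡ NA
    1+j≡NA = proj₂ A.last-index
    j<NA : j < NA
    j<NA = ≤-reflexive 1+j≡NA
    x : Fin NA
    x = A.point j j<NA

proposition4p12 : (C : PermSet) → IsPermClass C →
    (Σ ℕ λ m → Σ ℕ λ n → Σ (PMM m n) λ M → IsCyclic (mat M) ×
      ((K : ℕ) → Σ ℕ λ N → K ≤ N × Σ (Perm N) λ π → C π × IsCoil M π)) →
    ¬ IsLabelledWqo C
proposition4p12 C _ (m , n , M , _ , long-coils) =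
  antichain⇒¬IsLabelledWqo (Label-finite m n) labelled-coil antichain
  where
  len : ℕ → ℕ
  len = proj₁ (unbounded⇒increasing long-coils)

  len-mono : ∀ {i j} → i < j → len i < len j
  len-mono = proj₁ (proj₂ (unbounded⇒increasing long-coils))

  coil : ∀ s → Σ (Perm (len s)) λ π → C π × IsCoil M π
  coil = proj₂ (proj₂ (unbounded⇒increasing long-coils))

  gridded : ∀ s → GriddedCoil M (proj₁ (coil s)) (proj₁ (proj₂ (proj₂ (coil s))))
  gridded s = proj₂ (proj₂ (proj₂ (coil s)))

  labelled-coil : ℕ → LabelledIn C (Label m n)
  labelled-coil s = len s , proj₁ (coil s) , proj₁ (proj₂ (coil s)) , Coil.label (gridded s)

  antichain : ∀ {i j} → i < j → ¬ labelledOrder C _≡_ (labelled-coil i) (labelled-coil j)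
  antichain {i} {j} i<j (e , label-pres) =
    <⇒≢ (len-mono i<j) (LabelPreservingEmbedding.same-length (gridded i) (gridded j) e label-pres)
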